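{- For every positive integer $n$ with $n \equiv 0 \pmod 4$ or $n \equiv 1 \pmod 4$, the maximum number of colliders in a chain--collider--fork decomposition of the transitive tournament $TT_n$ is $\frac{n}{4}(n-2)$ when $n$ is even, and $\frac{(n-1)^2}{4}$ when $n$ is odd.
   Context: The transitive tournament $TT_n$ has vertex set $\{v_1,\dots,v_n\}$ and arc set $\{(v_i,v_j): 1\le i<j\le n\}$ (an arc $(u,v)$ is written $u\to v$). A chain is a digraph on three distinct vertices with arcs $a\to b\to c$; a collider is one with arcs $a\to b\leftarrow c$; a fork is one with arcs $a\leftarrow b\to c$. A chain--collider--fork decomposition of $TT_n$ is a partition of the arc set of $TT_n$ into two-element sets of arcs, each of which forms (as a subdigraph) a chain, a collider, or a fork. -}

module Defs where

open import Data.Nat using (ℕ; zero; suc; _+_)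
open import Data.Fin using (Fin; _<_)
open import Data.Product using (_×_; _,_; ∃; ∃-syntax; proj₁; proj₂)
open import Data.Sum using (_⊎_)
open import Data.List using (List; []; _∷_; map; concatMap)
open import Data.List.Membership.Propositional using (_∈_)
open import Data.List.Relation.Unary.All using (All)
open import Data.List.Relation.Unary.Unique.Propositional using (Unique)
open import Relation.Binary.PropositionalEquality using (_≡_; _≢_)

-- A (potential) arc u → v of a digraph on vertex set Fin n, as the pair (u , v).
Arc : ℕ → Set
Arc n = Fin n × Fin n

IsTTArc : {n : ℕ} → Arc n → Set
IsTTArc (i , j) = i < j

Distinct3 : {n : ℕ} → Fin n → Fin n → Fin n → Set
Distinct3 a b c = (a ≢ b) × (b ≢ c) × (a ≢ c)

-- The unordered two-arc set {e , f} equals {x , y}.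
SameSet : {n : ℕ} → Arc n → Arc n → Arc n → Arc n → Set
SameSet e f x y = ((e ≡ x) × (f ≡ y)) ⊎ ((e ≡ y) × (f ≡ x))

IsChain : {n : ℕ} → Arc n → Arc n → Set
IsChain e f = ∃[ a ] ∃[ b ] ∃[ c ] Distinct3 a b c × SameSet e f (a , b) (b , c)

IsCollider : {n : ℕ} → Arc n → Arc n → Set
IsCollider e f = ∃[ a ] ∃[ b ] ∃[ c ] Distinct3 a b c × SameSet e f (a , b) (c , b)

IsFork : {n : ℕ} → Arc n → Arc n → Set
IsFork e f = ∃[ a ] ∃[ b ] ∃[ c ] Distinct3 a b c × SameSet e f (b , a) (b , c)

data Kind : Set where
  chain collider fork : Kind

HasKind : {n : ℕ} → Kind → Arc n → Arc n → Set
HasKind chain    e f = IsChain e f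
HasKind collider e f = IsCollider e f
HasKind fork     e f = IsFork e f

Block : ℕ → Set
Block n = Kind × Arc n × Arc n

blockOK : {n : ℕ} → Block n → Set
blockOK (k , e , f) = HasKind k e f

arcsOf : {n : ℕ} → List (Block n) → List (Arc n)
arcsOf = concatMap (λ { (k , e , f) → e ∷ f ∷ [] })

IsCCFDecomposition : (n : ℕ) → List (Block n) → Set
IsCCFDecomposition n D =
  All blockOK D
  × Unique (arcsOf D)
  × All IsTTArc (arcsOf D)
  × (∀ (x : Arc n) → IsTTArc x → x ∈ arcsOf D)

colliders : {n : ℕ} → List (Block n) → ℕ
colliders [] = 0
colliders ((collider , _) ∷ D) = suc (colliders D)
colliders ((chain , _) ∷ D) = colliders D
colliders ((fork , _) ∷ D) = colliders D

IsMaxColliders : ℕ → ℕ → Set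
IsMaxColliders n k =
  (∃[ D ] IsCCFDecomposition n D × colliders D ≡ k)
  × (∀ D → IsCCFDecomposition n D → colliders D Data.Nat.≤ k)
  where import Data.Nat

{-# OPTIONS --safe #-}
-- Index the vertices from 0, as in Fin n. A collider consists of two arcs with a common head, and
-- v_m is the head of exactly m arcs, so at most ⌊m/2⌋ colliders have head v_m and a decomposition
-- has at most Σ_{m<n} ⌊m/2⌋ colliders: k(4k − 2) for n = 4k and 4k² = (n − 1)²/4 for n = 4k + 1.
-- The bound is attained by pairing the arcs into each vertex into colliders by consecutive tails.
-- Only v_{4j+1} and v_{4j+3} then have an arc left over; leaving out the tail v_{4j} at both, the
-- two leftover arcs v_{4j} → v_{4j+1} and v_{4j} → v_{4j+3} form a fork. For n ≡ 0, 1 (mod 4)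
-- every odd head is paired up in this way.
module Submission where

open import Defs
open import Data.Nat using (ℕ; zero; suc; _<_; _∸_; _*_; _^_; _/_; _%_; _+_; _≤_; z≤n; s≤s; s≤s⁻¹; ⌊_/2⌋; NonZero)
open import Data.Nat.Properties
open import Data.Nat.DivMod using (_mod_; m≡m%n+[m/n]*n; m*n/n≡m; m<n⇒m%n≡m)
open import Data.Nat.ListAction using (sum)
open import Data.Nat.Tactic.RingSolver using (solve-∀)
open import Data.Fin as Fin using (Fin; toℕ; fromℕ<)
open import Data.Fin.Properties using (toℕ<n; toℕ-injective; toℕ-fromℕ<; pigeonhole)
import Data.Fin.Properties as Finₚ
open import Data.Product using (_×_; _,_; proj₁; proj₂; map₂)
open import Data.Sum using (inj₁; inj₂)
open import Data.List using (List; []; _∷_; _++_; length; map; filter; lookup; applyDownFrom; downFrom)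
open import Data.List.Properties using (length-map; filter-accept; filter-reject; filter-all; filter-none; filter-++; length-++-≤ʳ)
open import Data.List.Membership.Propositional using (_∈_)
open import Data.List.Membership.Propositional.Properties using (∈-++⁺ˡ; ∈-++⁺ʳ; ∈-++⁻; ∈-map⁺; ∈-map⁻; ∈-lookup; ∈-downFrom⁺; ∈-downFrom⁻)
open import Data.List.Relation.Unary.All as All using (All; []; _∷_)
open import Data.List.Relation.Unary.All.Properties as All using (all-filter)
open import Data.List.Relation.Unary.AllPairs using ([]; _∷_)
open import Data.List.Relation.Unary.Unique.Propositional using (Unique)
open import Data.List.Relation.Unary.Unique.Propositional.Properties as Unique using (downFrom⁺)
open import Data.List.Relation.Binary.Permutation.Propositional using (_↭_; ↭-sym; ↭-trans; ↭-reflexive; prep; ↭⇒↭ₛ)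
open import Data.List.Relation.Binary.Permutation.Propositional.Properties using (All-resp-↭; ∈-resp-↭; ++⁺ˡ; shift)
import Data.List.Relation.Binary.Permutation.Setoid.Properties as Permutationₛ
open import Relation.Binary.PropositionalEquality
open import Relation.Binary.Definitions using (tri<; tri≈; tri>)
open import Relation.Nullary using (¬_; Dec; yes; no; contradiction)
open import Relation.Unary using (Decidable)
open import Function using (_∘_; _$_)

private
  variable
    A B : Set

Unique-resp-↭ : {xs ys : List A} → xs ↭ ys → Unique xs → Unique ys
Unique-resp-↭ {A = A} = Permutationₛ.Unique-resp-↭ (setoid A) ∘ ↭⇒↭ₛ

Unique-map⁺-injectiveOn : {P : A → Set} {f : A → B} →
  (∀ {x y} → P x → P y → f x ≡ f y → x ≡ y) →
  ∀ {xs} → All P xs → Unique xs → Unique (map f xs)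
Unique-map⁺-injectiveOn inj [] [] = []
Unique-map⁺-injectiveOn inj (px ∷ pxs) (x∉xs ∷ u) =
  All.map⁺ (All.zipWith (λ (x≢y , py) → x≢y ∘ inj px py) (x∉xs , pxs))
  ∷ Unique-map⁺-injectiveOn inj pxs u

Unique-lookup-injective : {xs : List A} → Unique xs →
  ∀ {i j} → i Fin.< j → lookup xs i ≢ lookup xs j
Unique-lookup-injective {xs = _ ∷ _} (x∉xs ∷ _) {Fin.zero} {Fin.suc j} _ = All.lookup x∉xs (∈-lookup j)
Unique-lookup-injective (_ ∷ u) {Fin.suc i} {Fin.suc j} (s≤s i<j) = Unique-lookup-injective u i<j

Unique-length≤ : ∀ {m} {xs : List ℕ} → Unique xs → All (_< m) xs → length xs ≤ m
Unique-length≤ {m} {xs} u xs<m with length xs ≤? m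
... | yes ≤m = ≤m
... | no ≰m =
  let i , j , i<j , same = pigeonhole (≰⇒> ≰m) bounded
  in contradiction (Finₚ.fromℕ<-injective _ _ _ _ same) (Unique-lookup-injective u i<j)
  where
  bounded : Fin (length xs) → Fin m
  bounded i = fromℕ< (All.lookup xs<m (∈-lookup i))

module _ {P : A → Set} (P? : Decidable P) where

  filter-accept₂ : ∀ {x y xs} → P x → P y → filter P? (x ∷ y ∷ xs) ≡ x ∷ y ∷ filter P? xs
  filter-accept₂ px py = trans (filter-accept P? px) (cong (_ ∷_) (filter-accept P? py))

  filter-reject₂ : ∀ {x y xs} → ¬ P x → ¬ P y → filter P? (x ∷ y ∷ xs) ≡ filter P? xs
  filter-reject₂ ¬px ¬py = trans (filter-reject P? ¬px) (filter-reject P? ¬py)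

  length-filter-++ʳ : ∀ xs ys → length (filter P? ys) ≤ length (filter P? (xs ++ ys))
  length-filter-++ʳ xs ys =
    subst (λ zs → _ ≤ length zs) (sym (filter-++ P? xs ys)) (length-++-≤ʳ (filter P? ys) {filter P? xs})

count : ℕ → List ℕ → ℕ
count m = length ∘ filter (_≟ m)

countBelow : ℕ → List ℕ → ℕ
countBelow m = length ∘ filter (_<? m)

countBelow-suc : ∀ m hs → countBelow (suc m) hs ≡ count m hs + countBelow m hs
countBelow-suc m [] = refl
countBelow-suc m (h ∷ hs) with <-cmp h m
... | tri< h<m h≢m _
  rewrite filter-accept (_<? suc m) {xs = hs} (m<n⇒m<1+n h<m)
        | filter-accept (_<? m) {xs = hs} h<m
        | filter-reject (_≟ m) {xs = hs} h≢m
  = trans (cong suc (countBelow-suc m hs)) (sym (+-suc _ _))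
... | tri≈ _ refl _
  rewrite filter-accept (_<? suc m) {xs = hs} (n<1+n m)
        | filter-reject (_<? m) {xs = hs} (n≮n m)
        | filter-accept (_≟ m) {xs = hs} refl
  = cong suc (countBelow-suc m hs)
... | tri> _ h≢m m<h
  rewrite filter-reject (_<? suc m) {xs = hs} (<⇒≱ m<h ∘ s≤s⁻¹)
        | filter-reject (_<? m) {xs = hs} (<⇒≯ m<h)
        | filter-reject (_≟ m) {xs = hs} h≢m
  = countBelow-suc m hs

length≤sum-counts : ∀ {f : ℕ → ℕ} {n hs} → All (_< n) hs →
  (∀ m → count m hs ≤ f m) → length hs ≤ sum (applyDownFrom f n)
length≤sum-counts {f} {n} {hs} hs<n count≤f =
  subst (_≤ _) (cong length (filter-all (_<? n) hs<n)) (countBelow≤ n)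
  where
  countBelow≤ : ∀ m → countBelow m hs ≤ sum (applyDownFrom f m)
  countBelow≤ zero = ≤-reflexive (cong length (filter-none (_<? 0) (All.universal (λ _ ()) hs)))
  countBelow≤ (suc m) = begin
    countBelow (suc m) hs         ≡⟨ countBelow-suc m hs ⟩
    count m hs + countBelow m hs  ≤⟨ +-mono-≤ (count≤f m) (countBelow≤ m) ⟩
    f m + sum (applyDownFrom f m) ∎
    where open ≤-Reasoning

sumHalves : ℕ → ℕ
sumHalves n = sum (applyDownFrom ⌊_/2⌋ n)

⌊m*2/2⌋≡m : ∀ m → ⌊ m * 2 /2⌋ ≡ m
⌊m*2/2⌋≡m zero = refl
⌊m*2/2⌋≡m (suc m) = cong suc (⌊m*2/2⌋≡m m)

⌊1+m*2/2⌋≡m : ∀ m → ⌊ 1 + m * 2 /2⌋ ≡ m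
⌊1+m*2/2⌋≡m zero = refl
⌊1+m*2/2⌋≡m (suc m) = cong suc (⌊1+m*2/2⌋≡m m)

*2≤⇒≤⌊/2⌋ : ∀ {c m} → c * 2 ≤ m → c ≤ ⌊ m /2⌋
*2≤⇒≤⌊/2⌋ {c} c*2≤m = subst (_≤ _) (⌊m*2/2⌋≡m c) (⌊n/2⌋-mono c*2≤m)

module _ {n : ℕ} where

  collider-head≡ : ∀ {e f : Arc n} → IsCollider e f → proj₂ e ≡ proj₂ f
  collider-head≡ (_ , _ , _ , _ , inj₁ (refl , refl)) = refl
  collider-head≡ (_ , _ , _ , _ , inj₂ (refl , refl)) = refl

  collider-ok : ∀ {a c h : Fin n} → c Fin.< a → a Fin.< h → IsCollider (a , h) (c , h)
  collider-ok c<a a<h =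
    _ , _ , _ , (Finₚ.<⇒≢ a<h , Finₚ.<⇒≢ (Finₚ.<-trans c<a a<h) ∘ sym , Finₚ.<⇒≢ c<a ∘ sym) , inj₁ (refl , refl)

  fork-ok : ∀ {t u v : Fin n} → t Fin.< u → u Fin.< v → IsFork (t , v) (t , u)
  fork-ok t<u u<v =
    _ , _ , _ , (Finₚ.<⇒≢ (Finₚ.<-trans t<u u<v) ∘ sym , Finₚ.<⇒≢ t<u , Finₚ.<⇒≢ u<v ∘ sym) , inj₁ (refl , refl)

  headIs? : (m : ℕ) (e : Arc n) → Dec (toℕ (proj₂ e) ≡ m)
  headIs? m e = toℕ (proj₂ e) ≟ m

  length-filter-headIs≤ : ∀ m {as : List (Arc n)} → Unique as → All IsTTArc as →
    length (filter (headIs? m) as) ≤ m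
  length-filter-headIs≤ m {as} u tt = begin
    length into                      ≡⟨ length-map tailℕ into ⟨
    length (map tailℕ into)          ≤⟨ Unique-length≤ tails-unique tails<m ⟩
    m                                ∎
    where
    open ≤-Reasoning
    into = filter (headIs? m) as
    tailℕ : Arc n → ℕ
    tailℕ = toℕ ∘ proj₁
    same-arc : ∀ {e f : Arc n} → toℕ (proj₂ e) ≡ m → toℕ (proj₂ f) ≡ m → tailℕ e ≡ tailℕ f → e ≡ f
    same-arc e↦m f↦m same-tail = cong₂ _,_ (toℕ-injective same-tail) (toℕ-injective (trans e↦m (sym f↦m)))
    tails-unique : Unique (map tailℕ into)
    tails-unique = Unique-map⁺-injectiveOn same-arc (all-filter (headIs? m) as) (Unique.filter⁺ (headIs? m) u)
    tails<m : All (_< m) (map tailℕ into)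
    tails<m = All.map⁺ (All.zipWith (λ (t<h , h≡m) → subst (_ <_) h≡m t<h)
                                    (All.filter⁺ (headIs? m) tt , all-filter (headIs? m) as))

  colliderHeads : List (Block n) → List ℕ
  colliderHeads [] = []
  colliderHeads ((collider , e , _) ∷ D) = toℕ (proj₂ e) ∷ colliderHeads D
  colliderHeads ((chain , _) ∷ D) = colliderHeads D
  colliderHeads ((fork , _) ∷ D) = colliderHeads D

  length-colliderHeads : ∀ D → length (colliderHeads D) ≡ colliders D
  length-colliderHeads [] = refl
  length-colliderHeads ((collider , _) ∷ D) = cong suc (length-colliderHeads D)
  length-colliderHeads ((chain , _) ∷ D) = length-colliderHeads D
  length-colliderHeads ((fork , _) ∷ D) = length-colliderHeads D

  colliderHeads<n : ∀ D → All (_< n) (colliderHeads D)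
  colliderHeads<n [] = []
  colliderHeads<n ((collider , e , _) ∷ D) = toℕ<n (proj₂ e) ∷ colliderHeads<n D
  colliderHeads<n ((chain , _) ∷ D) = colliderHeads<n D
  colliderHeads<n ((fork , _) ∷ D) = colliderHeads<n D

  count-colliderHeads*2≤ : ∀ m D → All blockOK D →
    count m (colliderHeads D) * 2 ≤ length (filter (headIs? m) (arcsOf D))
  count-colliderHeads*2≤ m [] [] = z≤n
  count-colliderHeads*2≤ m ((collider , e , f) ∷ D) (ok ∷ oks) with headIs? m e
  ... | yes e↦m = begin
    count m (toℕ (proj₂ e) ∷ colliderHeads D) * 2  ≡⟨ cong (λ hs → length hs * 2) (filter-accept (_≟ m) e↦m) ⟩
    2 + count m (colliderHeads D) * 2               ≤⟨ s≤s (s≤s (count-colliderHeads*2≤ m D oks)) ⟩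
    2 + length (filter (headIs? m) (arcsOf D))      ≡⟨ cong length (filter-accept₂ (headIs? m) e↦m f↦m) ⟨
    length (filter (headIs? m) (e ∷ f ∷ arcsOf D))  ∎
    where
    open ≤-Reasoning
    f↦m = trans (cong toℕ (sym (collider-head≡ ok))) e↦m
  ... | no e↛m = begin
    count m (toℕ (proj₂ e) ∷ colliderHeads D) * 2  ≡⟨ cong (λ hs → length hs * 2) (filter-reject (_≟ m) e↛m) ⟩
    count m (colliderHeads D) * 2                   ≤⟨ count-colliderHeads*2≤ m D oks ⟩
    length (filter (headIs? m) (arcsOf D))          ≡⟨ cong length (filter-reject₂ (headIs? m) e↛m f↛m) ⟨
    length (filter (headIs? m) (e ∷ f ∷ arcsOf D))  ∎
    where
    open ≤-Reasoning
    f↛m = e↛m ∘ trans (cong toℕ (collider-head≡ ok))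
  count-colliderHeads*2≤ m ((chain , e , f) ∷ D) (_ ∷ oks) =
    ≤-trans (count-colliderHeads*2≤ m D oks) (length-filter-++ʳ (headIs? m) (e ∷ f ∷ []) (arcsOf D))
  count-colliderHeads*2≤ m ((fork , e , f) ∷ D) (_ ∷ oks) =
    ≤-trans (count-colliderHeads*2≤ m D oks) (length-filter-++ʳ (headIs? m) (e ∷ f ∷ []) (arcsOf D))

  colliders≤sumHalves : ∀ D → IsCCFDecomposition n D → colliders D ≤ sumHalves n
  colliders≤sumHalves D (ok , u , tt , _) = begin
    colliders D               ≡⟨ length-colliderHeads D ⟨
    length (colliderHeads D)  ≤⟨ length≤sum-counts (colliderHeads<n D) count≤half ⟩
    sumHalves n               ∎
    where
    open ≤-Reasoning
    count≤half : ∀ m → count m (colliderHeads D) ≤ ⌊ m /2⌋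
    count≤half m = *2≤⇒≤⌊/2⌋ (≤-trans (count-colliderHeads*2≤ m D ok) (length-filter-headIs≤ m u tt))

-- Decompositions are built on the vertex set ℕ, where vertex arithmetic is free, and then
-- embedded into Fin N.

Arcℕ : Set
Arcℕ = ℕ × ℕ

Blockℕ : Set
Blockℕ = Kind × Arcℕ × Arcℕ

arcsOfℕ : List Blockℕ → List Arcℕ
arcsOfℕ [] = []
arcsOfℕ ((_ , e , f) ∷ D) = e ∷ f ∷ arcsOfℕ D

collidersℕ : List Blockℕ → ℕ
collidersℕ [] = 0
collidersℕ ((collider , _) ∷ D) = suc (collidersℕ D)
collidersℕ ((chain , _) ∷ D) = collidersℕ D
collidersℕ ((fork , _) ∷ D) = collidersℕ D

IsTTArcℕ : ℕ → Arcℕ → Set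
IsTTArcℕ n (a , b) = a < b × b < n

arcsInto : ℕ → ℕ → List Arcℕ
arcsInto h t = map (_, h) (downFrom t)

-- Heads in decreasing order and, for each head, tails in decreasing order: the order in which
-- pairUp and extend4 produce arcs, so that only one arc of extend4 is out of place.
ttArcsℕ : ℕ → List Arcℕ
ttArcsℕ zero = []
ttArcsℕ (suc n) = arcsInto n n ++ ttArcsℕ n

∈-arcsInto⁻ : ∀ {h t x} → x ∈ arcsInto h t → proj₁ x < t × proj₂ x ≡ h
∈-arcsInto⁻ x∈ with _ , i∈ , refl ← ∈-map⁻ _ x∈ = ∈-downFrom⁻ i∈ , refl

∈-ttArcsℕ⁻ : ∀ n {x} → x ∈ ttArcsℕ n → IsTTArcℕ n x
∈-ttArcsℕ⁻ (suc n) x∈ with ∈-++⁻ (arcsInto n n) x∈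
... | inj₁ x∈new with a<n , refl ← ∈-arcsInto⁻ x∈new = a<n , n<1+n n
... | inj₂ x∈old = map₂ m<n⇒m<1+n (∈-ttArcsℕ⁻ n x∈old)

∈-ttArcsℕ⁺ : ∀ n {a b} → a < b → b < n → (a , b) ∈ ttArcsℕ n
∈-ttArcsℕ⁺ (suc n) a<b b<1+n with m<1+n⇒m<n∨m≡n b<1+n
... | inj₁ b<n = ∈-++⁺ʳ (arcsInto n n) (∈-ttArcsℕ⁺ n a<b b<n)
... | inj₂ refl = ∈-++⁺ˡ (∈-map⁺ (_, n) (∈-downFrom⁺ a<b))

ttArcsℕ-unique : ∀ n → Unique (ttArcsℕ n)
ttArcsℕ-unique zero = []
ttArcsℕ-unique (suc n) =
  Unique.++⁺ (Unique.map⁺ (cong proj₁) (downFrom⁺ n)) (ttArcsℕ-unique n) disjoint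
  where
  disjoint : ∀ {x} → ¬ (x ∈ arcsInto n n × x ∈ ttArcsℕ n)
  disjoint (x∈new , x∈old) with _ , refl ← ∈-arcsInto⁻ x∈new = n≮n n (proj₂ (∈-ttArcsℕ⁻ n x∈old))

-- Only the order of the tails is recorded; the other inequalities making a block a collider or
-- a fork follow once its arcs are known to be arcs of TT_N.
data Shaped : Blockℕ → Set where
  collider< : ∀ {a c h} → c < a → Shaped (collider , (a , h) , (c , h))
  fork<     : ∀ {t u v} → u < v → Shaped (fork , (t , v) , (t , u))

pairUp : ℕ → ℕ → List Blockℕ → List Blockℕ
pairUp h (suc (suc t)) D = (collider , (suc t , h) , (t , h)) ∷ pairUp h t D
pairUp h _ D = D

pairUp-shaped : ∀ h t {D} → All Shaped D → All Shaped (pairUp h t D)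
pairUp-shaped h zero s = s
pairUp-shaped h (suc zero) s = s
pairUp-shaped h (suc (suc t)) s = collider< (n<1+n t) ∷ pairUp-shaped h t s

arcsOfℕ-pairUp : ∀ h k D → arcsOfℕ (pairUp h (k * 2) D) ≡ arcsInto h (k * 2) ++ arcsOfℕ D
arcsOfℕ-pairUp h zero D = refl
arcsOfℕ-pairUp h (suc k) D = cong (λ as → (suc (k * 2) , h) ∷ (k * 2 , h) ∷ as) (arcsOfℕ-pairUp h k D)

collidersℕ-pairUp : ∀ h t D → collidersℕ (pairUp h t D) ≡ ⌊ t /2⌋ + collidersℕ D
collidersℕ-pairUp h zero D = refl
collidersℕ-pairUp h (suc zero) D = refl
collidersℕ-pairUp h (suc (suc t)) D = cong suc (collidersℕ-pairUp h t D)

-- From TT_b to TT_{b+4}; the leftover arcs b → 1 + b and b → 3 + b form the fork.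
extend4 : ℕ → List Blockℕ → List Blockℕ
extend4 b D =
  (collider , (2 + b , 3 + b) , (1 + b , 3 + b)) ∷
  pairUp (3 + b) b (pairUp (2 + b) (2 + b) (
  (fork , (b , 3 + b) , (b , 1 + b)) ∷
  pairUp (1 + b) b (pairUp b b D)))

extend4-shaped : ∀ b {D} → All Shaped D → All Shaped (extend4 b D)
extend4-shaped b s =
  collider< (n<1+n (1 + b)) ∷
  pairUp-shaped (3 + b) b (pairUp-shaped (2 + b) (2 + b) (
  fork< (s≤s (s≤s (n≤1+n b))) ∷
  pairUp-shaped (1 + b) b (pairUp-shaped b b s)))

-- b is taken even: pairUp uses up all arcs into a vertex only for an even number of tails.
module _ (m : ℕ) (D : List Blockℕ) where
  private b = m * 2

  arcsOfℕ-extend4 : arcsOfℕ (extend4 b D) ≡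
    (2 + b , 3 + b) ∷ (1 + b , 3 + b) ∷ arcsInto (3 + b) b ++ arcsInto (2 + b) (2 + b) ++
    (b , 3 + b) ∷ (b , 1 + b) ∷ arcsInto (1 + b) b ++ arcsInto b b ++ arcsOfℕ D
  arcsOfℕ-extend4 = cong (λ as → (2 + b , 3 + b) ∷ (1 + b , 3 + b) ∷ as) $
    trans (arcsOfℕ-pairUp _ m _) $ cong (arcsInto (3 + b) b ++_) $
    trans (arcsOfℕ-pairUp _ (suc m) _) $ cong (λ as → arcsInto (2 + b) (2 + b) ++ (b , 3 + b) ∷ (b , 1 + b) ∷ as) $
    trans (arcsOfℕ-pairUp _ m _) $ cong (arcsInto (1 + b) b ++_) $
    arcsOfℕ-pairUp b m D

  extend4-↭ : arcsOfℕ D ↭ ttArcsℕ b → arcsOfℕ (extend4 b D) ↭ ttArcsℕ (4 + b)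
  extend4-↭ D↭ = ↭-trans (↭-reflexive arcsOfℕ-extend4) $ prep _ $ prep _ $
    ↭-trans (++⁺ˡ X (shift v Y _)) $ ↭-trans (shift v X _) $
    prep v $ ++⁺ˡ X $ ++⁺ˡ Y $ prep _ $ ++⁺ˡ (arcsInto (1 + b) b) $ ++⁺ˡ (arcsInto b b) D↭
    where
    v = (b , 3 + b)
    X = arcsInto (3 + b) b
    Y = arcsInto (2 + b) (2 + b)

  collidersℕ-extend4 : collidersℕ D ≡ sumHalves b → collidersℕ (extend4 b D) ≡ sumHalves (4 + b)
  collidersℕ-extend4 D≡ = trans peel (cong₂ (λ h c → suc (h + (suc ⌊ b /2⌋ + (h + (⌊ b /2⌋ + c))))) even D≡)
    where
    peel : collidersℕ (extend4 b D) ≡ suc (⌊ b /2⌋ + (⌊ 2 + b /2⌋ + (⌊ b /2⌋ + (⌊ b /2⌋ + collidersℕ D))))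
    peel = cong suc $
      trans (collidersℕ-pairUp _ b _) $ cong (⌊ b /2⌋ +_) $
      trans (collidersℕ-pairUp _ (2 + b) _) $ cong (⌊ 2 + b /2⌋ +_) $
      trans (collidersℕ-pairUp _ b _) $ cong (⌊ b /2⌋ +_) $
      collidersℕ-pairUp b b D
    even : ⌊ b /2⌋ ≡ ⌊ 1 + b /2⌋
    even = trans (⌊m*2/2⌋≡m m) (sym (⌊1+m*2/2⌋≡m m))

decomposition4 : ℕ → List Blockℕ
decomposition4 zero = []
decomposition4 (suc k) = extend4 (k * 2 * 2) (decomposition4 k)

decomposition4-shaped : ∀ k → All Shaped (decomposition4 k)
decomposition4-shaped zero = []
decomposition4-shaped (suc k) = extend4-shaped _ (decomposition4-shaped k)

decomposition4-↭ : ∀ k → arcsOfℕ (decomposition4 k) ↭ ttArcsℕ (k * 2 * 2)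
decomposition4-↭ zero = ↭-reflexive refl
decomposition4-↭ (suc k) = extend4-↭ (k * 2) _ (decomposition4-↭ k)

collidersℕ-decomposition4 : ∀ k → collidersℕ (decomposition4 k) ≡ sumHalves (k * 2 * 2)
collidersℕ-decomposition4 zero = refl
collidersℕ-decomposition4 (suc k) = collidersℕ-extend4 (k * 2) _ (collidersℕ-decomposition4 k)

module Embedding (N : ℕ) .{{_ : NonZero N}} where

  -- Only applied to a < N; `mod` merely makes it total.
  vertex : ℕ → Fin N
  vertex a = a mod N

  toℕ-vertex : ∀ {a} → a < N → toℕ (vertex a) ≡ a
  toℕ-vertex a<N = trans (toℕ-fromℕ< _) (m<n⇒m%n≡m a<N)

  vertex-toℕ : ∀ i → vertex (toℕ i) ≡ i
  vertex-toℕ i = toℕ-injective (toℕ-vertex (toℕ<n i))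

  vertex-< : ∀ {a b} → a < b → b < N → vertex a Fin.< vertex b
  vertex-< a<b b<N = subst₂ _<_ (sym (toℕ-vertex (<-trans a<b b<N))) (sym (toℕ-vertex b<N)) a<b

  vertex-injectiveOn : ∀ {a c} → a < N → c < N → vertex a ≡ vertex c → a ≡ c
  vertex-injectiveOn a<N c<N ≡vertex = trans (sym (toℕ-vertex a<N)) (trans (cong toℕ ≡vertex) (toℕ-vertex c<N))

  arc : Arcℕ → Arc N
  arc (a , b) = vertex a , vertex b

  arc-injectiveOn : ∀ {x y} → IsTTArcℕ N x → IsTTArcℕ N y → arc x ≡ arc y → x ≡ y
  arc-injectiveOn (a<b , b<N) (c<d , d<N) ≡arc = cong₂ _,_
    (vertex-injectiveOn (<-trans a<b b<N) (<-trans c<d d<N) (cong proj₁ ≡arc))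
    (vertex-injectiveOn b<N d<N (cong proj₂ ≡arc))

  block : Blockℕ → Block N
  block (k , e , f) = k , arc e , arc f

  arcsOf-map-block : ∀ L → arcsOf (map block L) ≡ map arc (arcsOfℕ L)
  arcsOf-map-block [] = refl
  arcsOf-map-block ((_ , e , f) ∷ L) = cong (λ as → arc e ∷ arc f ∷ as) (arcsOf-map-block L)

  colliders-map-block : ∀ L → colliders (map block L) ≡ collidersℕ L
  colliders-map-block [] = refl
  colliders-map-block ((collider , _) ∷ L) = cong suc (colliders-map-block L)
  colliders-map-block ((chain , _) ∷ L) = colliders-map-block L
  colliders-map-block ((fork , _) ∷ L) = colliders-map-block L

  block-ok : ∀ {k e f} → Shaped (k , e , f) → IsTTArcℕ N e → IsTTArcℕ N f → HasKind k (arc e) (arc f)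
  block-ok (collider< c<a) (a<h , h<N) _ = collider-ok (vertex-< c<a (<-trans a<h h<N)) (vertex-< a<h h<N)
  block-ok (fork< u<v) (_ , v<N) (t<u , u<N) = fork-ok (vertex-< t<u u<N) (vertex-< u<v v<N)

  blocks-ok : ∀ {L} → All Shaped L → All (IsTTArcℕ N) (arcsOfℕ L) → All blockOK (map block L)
  blocks-ok [] [] = []
  blocks-ok (s ∷ ss) (te ∷ tf ∷ ts) = block-ok s te tf ∷ blocks-ok ss ts

  embed : ∀ L → All Shaped L → arcsOfℕ L ↭ ttArcsℕ N → IsCCFDecomposition N (map block L)
  embed L shaped L↭ = blocks-ok shaped tt , unique , all-tt , complete
    where
    tt : All (IsTTArcℕ N) (arcsOfℕ L)
    tt = All-resp-↭ (↭-sym L↭) (All.tabulate (∈-ttArcsℕ⁻ N))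
    unique : Unique (arcsOf (map block L))
    unique = subst Unique (sym (arcsOf-map-block L))
      (Unique-map⁺-injectiveOn arc-injectiveOn tt (Unique-resp-↭ (↭-sym L↭) (ttArcsℕ-unique N)))
    all-tt : All IsTTArc (arcsOf (map block L))
    all-tt = subst (All IsTTArc) (sym (arcsOf-map-block L))
      (All.map⁺ (All.map (λ (a<b , b<N) → vertex-< a<b b<N) tt))
    complete : ∀ x → IsTTArc x → x ∈ arcsOf (map block L)
    complete (i , j) i<j = subst (_ ∈_) (sym (arcsOf-map-block L)) $
      subst (_∈ _) (cong₂ _,_ (vertex-toℕ i) (vertex-toℕ j)) $
      ∈-map⁺ arc (∈-resp-↭ (↭-sym L↭) (∈-ttArcsℕ⁺ N i<j (toℕ<n j)))

isMaxColliders : ∀ {n} D → IsCCFDecomposition n D → colliders D ≡ sumHalves n →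
  IsMaxColliders n (sumHalves n)
isMaxColliders D isDec D≡ = (D , isDec , D≡) , colliders≤sumHalves

isMaxColliders-embed : ∀ N .{{_ : NonZero N}} L → All Shaped L → arcsOfℕ L ↭ ttArcsℕ N →
  collidersℕ L ≡ sumHalves N → IsMaxColliders N (sumHalves N)
isMaxColliders-embed N L shaped L↭ L≡ =
  isMaxColliders (map block L) (embed L shaped L↭) (trans (colliders-map-block L) L≡)
  where open Embedding N

isMaxColliders-4k : ∀ k → 0 < k * 2 * 2 → IsMaxColliders (k * 2 * 2) (sumHalves (k * 2 * 2))
isMaxColliders-4k zero ()
isMaxColliders-4k k@(suc _) _ = isMaxColliders-embed _ (decomposition4 k)
  (decomposition4-shaped k) (decomposition4-↭ k) (collidersℕ-decomposition4 k)

isMaxColliders-4k+1 : ∀ k → IsMaxColliders (suc (k * 2 * 2)) (sumHalves (suc (k * 2 * 2)))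
isMaxColliders-4k+1 k = isMaxColliders-embed _ (pairUp b b (decomposition4 k))
  (pairUp-shaped b b (decomposition4-shaped k))
  (↭-trans (↭-reflexive (arcsOfℕ-pairUp b (k * 2) _)) (++⁺ˡ (arcsInto b b) (decomposition4-↭ k)))
  (trans (collidersℕ-pairUp b b _) (cong (⌊ b /2⌋ +_) (collidersℕ-decomposition4 k)))
  where b = k * 2 * 2

sumHalves-4+ : ∀ m → sumHalves (4 + m * 2) ≡ suc m + (suc m + (m + (m + sumHalves (m * 2))))
sumHalves-4+ m = cong₂ (λ h₀ h₁ → suc h₁ + (suc h₀ + (h₁ + (h₀ + sumHalves (m * 2)))))
  (⌊m*2/2⌋≡m m) (⌊1+m*2/2⌋≡m m)

sumHalves-4k+2k : ∀ k → sumHalves (k * 2 * 2) + k * 2 ≡ k * (k * 2 * 2)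
sumHalves-4k+2k zero = refl
sumHalves-4k+2k (suc k) = begin
  sumHalves (4 + k * 2 * 2) + suc k * 2                             ≡⟨ cong (_+ suc k * 2) (sumHalves-4+ (k * 2)) ⟩
  suc (k * 2) + (suc (k * 2) + (k * 2 + (k * 2 + S))) + suc k * 2   ≡⟨ regroup k S ⟩
  (S + k * 2) + (k * 8 + 4)                                         ≡⟨ cong (_+ (k * 8 + 4)) (sumHalves-4k+2k k) ⟩
  k * (k * 2 * 2) + (k * 8 + 4)                                     ≡⟨ expand k ⟩
  suc k * (suc k * 2 * 2)                                           ∎
  where
  open ≡-Reasoning
  S = sumHalves (k * 2 * 2)
  regroup : ∀ k S → suc (k * 2) + (suc (k * 2) + (k * 2 + (k * 2 + S))) + suc k * 2 ≡ (S + k * 2) + (k * 8 + 4)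
  regroup = solve-∀
  expand : ∀ k → k * (k * 2 * 2) + (k * 8 + 4) ≡ suc k * (suc k * 2 * 2)
  expand = solve-∀

sumHalves-4k : ∀ k → sumHalves (k * 2 * 2) ≡ k * (k * 2 * 2 ∸ 2)
sumHalves-4k k = sym $ begin
  k * (k * 2 * 2 ∸ 2)                        ≡⟨ *-distribˡ-∸ k (k * 2 * 2) 2 ⟩
  k * (k * 2 * 2) ∸ k * 2                    ≡⟨ cong (_∸ k * 2) (sumHalves-4k+2k k) ⟨
  sumHalves (k * 2 * 2) + k * 2 ∸ k * 2      ≡⟨ m+n∸n≡m _ (k * 2) ⟩
  sumHalves (k * 2 * 2)                      ∎
  where open ≡-Reasoning

sumHalves-4k+1 : ∀ k → sumHalves (1 + k * 2 * 2) ≡ ((k * 2 * 2) ^ 2) / 4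
sumHalves-4k+1 k = sym $ begin
  ((k * 2 * 2) ^ 2) / 4                      ≡⟨ cong (_/ 4) (square k) ⟩
  (k * (k * 2 * 2) * 4) / 4                  ≡⟨ m*n/n≡m (k * (k * 2 * 2)) 4 ⟩
  k * (k * 2 * 2)                            ≡⟨ sumHalves-4k+2k k ⟨
  sumHalves (k * 2 * 2) + k * 2              ≡⟨ +-comm _ (k * 2) ⟩
  k * 2 + sumHalves (k * 2 * 2)              ≡⟨ cong (_+ sumHalves (k * 2 * 2)) (⌊m*2/2⌋≡m (k * 2)) ⟨
  sumHalves (1 + k * 2 * 2)                  ∎
  where
  open ≡-Reasoning
  -- (k * 2 * 2) ^ 2 unfolded: the ring solver does not accept _^_ here.
  square : ∀ k → (k * 2 * 2) * ((k * 2 * 2) * 1) ≡ k * (k * 2 * 2) * 4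
  square = solve-∀

mainTheorem6 : (n : ℕ) → 0 < n →
    (n % 4 ≡ 0 → IsMaxColliders n ((n / 4) * (n ∸ 2)))
    × (n % 4 ≡ 1 → IsMaxColliders n (((n ∸ 1) ^ 2) / 4))
mainTheorem6 n 0<n = multiple , multiple+1
  where
  k = n / 4
  n≡ : ∀ {r} → n % 4 ≡ r → n ≡ r + k * 2 * 2
  n≡ n%4≡r = trans (m≡m%n+[m/n]*n n 4) (cong₂ _+_ n%4≡r (sym (*-assoc k 2 2)))
  multiple : n % 4 ≡ 0 → IsMaxColliders n (k * (n ∸ 2))
  multiple n%4≡0 = subst (λ m → IsMaxColliders m (k * (m ∸ 2))) (sym (n≡ n%4≡0)) $
    subst (IsMaxColliders _) (sumHalves-4k k) (isMaxColliders-4k k (subst (0 <_) (n≡ n%4≡0) 0<n))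
  multiple+1 : n % 4 ≡ 1 → IsMaxColliders n (((n ∸ 1) ^ 2) / 4)
  multiple+1 n%4≡1 = subst (λ m → IsMaxColliders m (((m ∸ 1) ^ 2) / 4)) (sym (n≡ n%4≡1)) $
    subst (IsMaxColliders _) (sumHalves-4k+1 k) (isMaxColliders-4k+1 k)
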